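{- Let $A$ be a bounded pseudo-hoop and let $F$ be a normal filter of $A$. Then $F$ is an involutive filter of $A$ if and only if the quotient $A/F$ is an involutive pseudo-hoop.
   Context: A pseudo-hoop is an algebra $(A,\odot,\rightarrow,\rightsquigarrow,1)$ of type $(2,2,2,0)$ such that for all $x,y,z\in A$: $x\odot 1=1\odot x=x$; $x\rightarrow x=x\rightsquigarrow x=1$; $(x\odot y)\rightarrow z=x\rightarrow(y\rightarrow z)$; $(x\odot y)\rightsquigarrow z=y\rightsquigarrow(x\rightsquigarrow z)$; $(x\rightarrow y)\odot x=(y\rightarrow x)\odot y=x\odot(x\rightsquigarrow y)=y\odot(y\rightsquigarrow x)$. The order is $x\le y$ iff $x\rightarrow y=1$. It is bounded if it has a least element $0$; then $x^-=x\rightarrow 0$, $x^\sim=x\rightsquigarrow 0$, $x^{ -\sim}=(x^-)^\sim$, $x^{\sim- }=(x^\sim)^-$. A bounded pseudo-hoop is involutive if $x^{ -\sim}=x^{\sim- }=x$ for all $x$. A filter is a nonempty $F\subseteq A$ closed under $\odot$ and upward closed; it is normal if for all $x,y$: $x\rightarrow y\in F$ iff $x\rightsquigarrow y\in F$; it is involutive if $x^{ -\sim}\rightarrow x\in F$ and $x^{\sim- }\rightsquigarrow x\in F$ for all $x$. For a normal filter $F$, the relation $\Theta_F$ given by $(x,y)\in\Theta_F$ iff $x\rightarrow y\in F$ and $y\rightarrow x\in F$ is a congruence of $A$, and $A/F$ denotes the quotient pseudo-hoop $A/\Theta_F$ (bounded with least element the class of $0$). -}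

module Defs where

open import Level using (Level; _⊔_; suc)
open import Data.Product using (_×_; Σ; ∃)
open import Relation.Binary.PropositionalEquality using (_≡_)

record PseudoHoop (a : Level) : Set (suc a) where
  infixl 7 _⊙_
  infixr 5 _⇒_ _⇝_
  field
    Carrier : Set a
    _⊙_     : Carrier → Carrier → Carrier
    _⇒_     : Carrier → Carrier → Carrier
    _⇝_     : Carrier → Carrier → Carrier
    𝟙       : Carrier
    ⊙-identityʳ : ∀ x → x ⊙ 𝟙 ≡ x
    ⊙-identityˡ : ∀ x → 𝟙 ⊙ x ≡ x
    ⇒-refl  : ∀ x → x ⇒ x ≡ 𝟙
    ⇝-refl  : ∀ x → x ⇝ x ≡ 𝟙
    ⊙-⇒     : ∀ x y z → (x ⊙ y) ⇒ z ≡ x ⇒ (y ⇒ z)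
    ⊙-⇝     : ∀ x y z → (x ⊙ y) ⇝ z ≡ y ⇝ (x ⇝ z)
    div₁    : ∀ x y → (x ⇒ y) ⊙ x ≡ (y ⇒ x) ⊙ y
    div₂    : ∀ x y → (y ⇒ x) ⊙ y ≡ x ⊙ (x ⇝ y)
    div₃    : ∀ x y → x ⊙ (x ⇝ y) ≡ y ⊙ (y ⇝ x)

  _≤_ : Carrier → Carrier → Set a
  x ≤ y = x ⇒ y ≡ 𝟙

record BoundedPseudoHoop (a : Level) : Set (suc a) where
  field
    pseudoHoop : PseudoHoop a
  open PseudoHoop pseudoHoop public
  field
    𝟘      : Carrier
    𝟘-least : ∀ x → 𝟘 ≤ x

  _⁻ : Carrier → Carrier
  x ⁻ = x ⇒ 𝟘

  _∼ : Carrier → Carrier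
  x ∼ = x ⇝ 𝟘

-- Raw bounded pseudo-hoop operations over a carrier equipped with an
-- equality relation _≈_ (used to express A itself, with ≈ = ≡, and the
-- quotient A/F, with ≈ = Θ_F, without quotient types).
record RawBoundedPseudoHoop (a ℓ : Level) : Set (suc (a ⊔ ℓ)) where
  field
    Carrier : Set a
    _≈_     : Carrier → Carrier → Set ℓ
    _⊙_     : Carrier → Carrier → Carrier
    _⇒_     : Carrier → Carrier → Carrier
    _⇝_     : Carrier → Carrier → Carrier
    𝟙       : Carrier
    𝟘       : Carrier

IsInvolutive : ∀ {a ℓ} → RawBoundedPseudoHoop a ℓ → Set (a ⊔ ℓ)
IsInvolutive R = ∀ x → (((x ⇒ 𝟘) ⇝ 𝟘) ≈ x) × (((x ⇝ 𝟘) ⇒ 𝟘) ≈ x)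
  where open RawBoundedPseudoHoop R

module _ {a : Level} (A : BoundedPseudoHoop a) where
  open BoundedPseudoHoop A

  record IsFilter {f : Level} (F : Carrier → Set f) : Set (a ⊔ f) where
    field
      nonempty : ∃ F
      ⊙-closed : ∀ {x y} → F x → F y → F (x ⊙ y)
      up-closed : ∀ {x y} → F x → x ≤ y → F y

  record IsNormalFilter {f : Level} (F : Carrier → Set f) : Set (a ⊔ f) where
    field
      isFilter : IsFilter F
      normal→ : ∀ {x y} → F (x ⇒ y) → F (x ⇝ y)
      normal← : ∀ {x y} → F (x ⇝ y) → F (x ⇒ y)

  IsInvolutiveFilter : ∀ {f} → (F : Carrier → Set f) → Set (a ⊔ f)
  IsInvolutiveFilter F = ∀ x → F (((x ⁻) ∼) ⇒ x) × F (((x ∼) ⁻) ⇝ x)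

  Θ : ∀ {f} → (F : Carrier → Set f) → Carrier → Carrier → Set f
  Θ F x y = F (x ⇒ y) × F (y ⇒ x)

  Quotient : ∀ {f} → (F : Carrier → Set f) → IsNormalFilter F →
             RawBoundedPseudoHoop a f
  Quotient F _ = record
    { Carrier = Carrier
    ; _≈_ = Θ F
    ; _⊙_ = _⊙_
    ; _⇒_ = _⇒_
    ; _⇝_ = _⇝_
    ; 𝟙 = 𝟙
    ; 𝟘 = 𝟘
    }

-- In any bounded pseudo-hoop x ≤ x⁻∼ and x ≤ x∼⁻, because x⁻ ⊙ x = x ⊙ x∼ = 0.
-- So the pair (x⁻∼, x) lies in Θ_F exactly when x⁻∼ → x ∈ F, and (x∼⁻, x)
-- exactly when x∼⁻ → x ∈ F, which a normal filter turns into x∼⁻ ⇝ x ∈ F.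
module Submission where

open import Defs
open import Level using (Level)
open import Function.Bundles using (_⇔_; mk⇔)
open import Data.Product using (_,_; proj₁; proj₂)
open import Relation.Binary.PropositionalEquality
  using (_≡_; sym; trans; cong; cong₂; subst; module ≡-Reasoning)

module PseudoHoopProperties {a : Level} (A : PseudoHoop a) where
  open PseudoHoop A
  open ≡-Reasoning

  -- The meet of the paper; the axioms div₁–div₃ say that its four usual expressions agree.
  infixl 6 _∧_
  _∧_ : Carrier → Carrier → Carrier
  x ∧ y = (x ⇒ y) ⊙ x

  x∧y≡[y⇒x]⊙y : ∀ x y → x ∧ y ≡ (y ⇒ x) ⊙ y
  x∧y≡[y⇒x]⊙y = div₁

  x∧y≡x⊙[x⇝y] : ∀ x y → x ∧ y ≡ x ⊙ (x ⇝ y)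
  x∧y≡x⊙[x⇝y] x y = trans (div₁ x y) (div₂ x y)

  x≤y⇒x∧y≡x : ∀ {x y} → x ≤ y → x ∧ y ≡ x
  x≤y⇒x∧y≡x {x} x≤y = trans (cong (_⊙ x) x≤y) (⊙-identityˡ x)

  y≤x⇒x∧y≡y : ∀ {x y} → y ≤ x → x ∧ y ≡ y
  y≤x⇒x∧y≡y {x} {y} y≤x = trans (x∧y≡[y⇒x]⊙y x y) (x≤y⇒x∧y≡x y≤x)

  x⇝y≡𝟙⇒x∧y≡x : ∀ {x y} → x ⇝ y ≡ 𝟙 → x ∧ y ≡ x
  x⇝y≡𝟙⇒x∧y≡x {x} {y} x⇝y≡𝟙 =
    trans (x∧y≡x⊙[x⇝y] x y) (trans (cong (x ⊙_) x⇝y≡𝟙) (⊙-identityʳ x))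

  ≤-antisym : ∀ {x y} → x ≤ y → y ≤ x → x ≡ y
  ≤-antisym x≤y y≤x = trans (sym (x≤y⇒x∧y≡x x≤y)) (y≤x⇒x∧y≡y y≤x)

  ⊙-assoc : ∀ x y z → x ⊙ (y ⊙ z) ≡ (x ⊙ y) ⊙ z
  ⊙-assoc x y z =
    ≤-antisym (trans (same-residuals _) (⇒-refl _))
              (trans (sym (same-residuals _)) (⇒-refl _))
    where
    same-residuals : ∀ t → (x ⊙ (y ⊙ z)) ⇒ t ≡ ((x ⊙ y) ⊙ z) ⇒ t
    same-residuals t = begin
      (x ⊙ (y ⊙ z)) ⇒ t   ≡⟨ ⊙-⇒ x (y ⊙ z) t ⟩
      x ⇒ ((y ⊙ z) ⇒ t)   ≡⟨ cong (x ⇒_) (⊙-⇒ y z t) ⟩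
      x ⇒ (y ⇒ (z ⇒ t))   ≡⟨ sym (⊙-⇒ x y (z ⇒ t)) ⟩
      (x ⊙ y) ⇒ (z ⇒ t)   ≡⟨ sym (⊙-⇒ (x ⊙ y) z t) ⟩
      ((x ⊙ y) ⊙ z) ⇒ t   ∎

  x∧𝟙≡𝟙⇒x : ∀ x → x ∧ 𝟙 ≡ 𝟙 ⇒ x
  x∧𝟙≡𝟙⇒x x = trans (x∧y≡[y⇒x]⊙y x 𝟙) (⊙-identityʳ (𝟙 ⇒ x))

  ⇒-identityˡ : ∀ x → 𝟙 ⇒ x ≡ x
  ⇒-identityˡ x = sym (begin
    x                          ≡⟨ sym (x≤y⇒x∧y≡x x≤𝟙⇒x) ⟩
    x ∧ (𝟙 ⇒ x)                ≡⟨ x∧y≡[y⇒x]⊙y x (𝟙 ⇒ x) ⟩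
    ((𝟙 ⇒ x) ⇒ x) ⊙ (𝟙 ⇒ x)    ≡⟨ cong₂ _⊙_ [𝟙⇒x]⇒x≡x′⇒𝟙 (sym (x∧𝟙≡𝟙⇒x x)) ⟩
    (x′ ⇒ 𝟙) ⊙ (x′ ⊙ x)        ≡⟨ ⊙-assoc (x′ ⇒ 𝟙) x′ x ⟩
    (x′ ∧ 𝟙) ⊙ x               ≡⟨ cong (_⊙ x) (trans (x∧𝟙≡𝟙⇒x x′) 𝟙⇒x′≡x′) ⟩
    x ∧ 𝟙                      ≡⟨ x∧𝟙≡𝟙⇒x x ⟩
    𝟙 ⇒ x                      ∎)
    where
    x′ : Carrier
    x′ = x ⇒ 𝟙
    x≤𝟙⇒x : x ≤ (𝟙 ⇒ x)
    x≤𝟙⇒x = trans (sym (⊙-⇒ x 𝟙 x)) (trans (cong (_⇒ x) (⊙-identityʳ x)) (⇒-refl x))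
    [𝟙⇒x]⇒x≡x′⇒𝟙 : (𝟙 ⇒ x) ⇒ x ≡ x′ ⇒ 𝟙
    [𝟙⇒x]⇒x≡x′⇒𝟙 = begin
      (𝟙 ⇒ x) ⇒ x    ≡⟨ cong (_⇒ x) (sym (x∧𝟙≡𝟙⇒x x)) ⟩
      (x′ ⊙ x) ⇒ x   ≡⟨ ⊙-⇒ x′ x x ⟩
      x′ ⇒ (x ⇒ x)   ≡⟨ cong (x′ ⇒_) (⇒-refl x) ⟩
      x′ ⇒ 𝟙         ∎
    𝟙⇒x′≡x′ : 𝟙 ⇒ x′ ≡ x′
    𝟙⇒x′≡x′ = trans (sym (⊙-⇒ 𝟙 x 𝟙)) (cong (_⇒ 𝟙) (⊙-identityˡ x))

  x∧𝟙≡x : ∀ x → x ∧ 𝟙 ≡ x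
  x∧𝟙≡x x = trans (x∧𝟙≡𝟙⇒x x) (⇒-identityˡ x)

  ⇒-zeroʳ : ∀ x → x ⇒ 𝟙 ≡ 𝟙
  ⇒-zeroʳ x = sym (begin
    𝟙                        ≡⟨ sym (⇒-refl (x ⇒ 𝟙)) ⟩
    (x ⇒ 𝟙) ⇒ (x ⇒ 𝟙)        ≡⟨ sym (⊙-⇒ (x ⇒ 𝟙) x 𝟙) ⟩
    ((x ⇒ 𝟙) ⊙ x) ⇒ 𝟙        ≡⟨ cong (_⇒ 𝟙) (x∧𝟙≡x x) ⟩
    x ⇒ 𝟙                    ∎)

  ⇝≡𝟙⇒≤ : ∀ {x y} → x ⇝ y ≡ 𝟙 → x ≤ y
  ⇝≡𝟙⇒≤ {x} {y} x⇝y≡𝟙 = begin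
    x ⇒ y                    ≡⟨ cong (_⇒ y) x≡[y⇒x]⊙y ⟩
    ((y ⇒ x) ⊙ y) ⇒ y        ≡⟨ ⊙-⇒ (y ⇒ x) y y ⟩
    (y ⇒ x) ⇒ (y ⇒ y)        ≡⟨ cong ((y ⇒ x) ⇒_) (⇒-refl y) ⟩
    (y ⇒ x) ⇒ 𝟙              ≡⟨ ⇒-zeroʳ (y ⇒ x) ⟩
    𝟙                        ∎
    where
    x≡[y⇒x]⊙y : x ≡ (y ⇒ x) ⊙ y
    x≡[y⇒x]⊙y = trans (sym (x⇝y≡𝟙⇒x∧y≡x x⇝y≡𝟙)) (x∧y≡[y⇒x]⊙y x y)

module BoundedPseudoHoopProperties {a : Level} (A : BoundedPseudoHoop a) where
  open BoundedPseudoHoop A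
  open PseudoHoopProperties pseudoHoop
  open ≡-Reasoning

  x⁻⊙x≡𝟘 : ∀ x → (x ⁻) ⊙ x ≡ 𝟘
  x⁻⊙x≡𝟘 x = y≤x⇒x∧y≡y (𝟘-least x)

  x⊙x∼≡𝟘 : ∀ x → x ⊙ (x ∼) ≡ 𝟘
  x⊙x∼≡𝟘 x = trans (sym (x∧y≡x⊙[x⇝y] x 𝟘)) (y≤x⇒x∧y≡y (𝟘-least x))

  x≤x⁻∼ : ∀ x → x ≤ ((x ⁻) ∼)
  x≤x⁻∼ x = ⇝≡𝟙⇒≤ (begin
    x ⇝ ((x ⁻) ⇝ 𝟘)    ≡⟨ sym (⊙-⇝ (x ⁻) x 𝟘) ⟩
    ((x ⁻) ⊙ x) ⇝ 𝟘    ≡⟨ cong (_⇝ 𝟘) (x⁻⊙x≡𝟘 x) ⟩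
    𝟘 ⇝ 𝟘              ≡⟨ ⇝-refl 𝟘 ⟩
    𝟙                  ∎)

  x≤x∼⁻ : ∀ x → x ≤ ((x ∼) ⁻)
  x≤x∼⁻ x = begin
    x ⇒ ((x ∼) ⇒ 𝟘)    ≡⟨ sym (⊙-⇒ x (x ∼) 𝟘) ⟩
    (x ⊙ (x ∼)) ⇒ 𝟘    ≡⟨ cong (_⇒ 𝟘) (x⊙x∼≡𝟘 x) ⟩
    𝟘 ⇒ 𝟘              ≡⟨ ⇒-refl 𝟘 ⟩
    𝟙                  ∎

module FilterProperties {a f : Level} (A : BoundedPseudoHoop a)
                        {F : BoundedPseudoHoop.Carrier A → Set f}
                        (isFilter : IsFilter A F) where
  open BoundedPseudoHoop A
  open IsFilter isFilter
  open PseudoHoopProperties pseudoHoop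

  𝟙∈F : F 𝟙
  𝟙∈F = up-closed (proj₂ nonempty) (⇒-zeroʳ _)

  ≤⇒∈F : ∀ {x y} → x ≤ y → F (x ⇒ y)
  ≤⇒∈F x≤y = subst F (sym x≤y) 𝟙∈F

theorem4p13 : ∀ {a f : Level} (A : BoundedPseudoHoop a) (F : BoundedPseudoHoop.Carrier A → Set f)
                (N : IsNormalFilter A F) →
                IsInvolutiveFilter A F ⇔ IsInvolutive (Quotient A F N)
theorem4p13 A F N = mk⇔ to from
  where
  open BoundedPseudoHoop A
  open BoundedPseudoHoopProperties A
  open IsNormalFilter N
  open FilterProperties A isFilter

  to : IsInvolutiveFilter A F → IsInvolutive (Quotient A F N)
  to inv x = (proj₁ (inv x) , ≤⇒∈F (x≤x⁻∼ x))
           , (normal← (proj₂ (inv x)) , ≤⇒∈F (x≤x∼⁻ x))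

  from : IsInvolutive (Quotient A F N) → IsInvolutiveFilter A F
  from inv x = proj₁ (proj₁ (inv x)) , normal→ (proj₁ (proj₂ (inv x)))
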